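{- Let $f\colon X\to Y$ be a morphism in $\mathbf{OMLatGal}$. (i) The image $i_f=\ker(\mathrm{coker}(f))$ is $i_f\colon{\downarrow}(f_*(1)^\perp)\to Y$ with $(i_f)_*(v)=v^\perp$ and $(i_f)^*(y)=y^\perp\wedge f_*(1)^\perp$. (ii) The morphism $e_f\colon X\to{\downarrow}(f_*(1)^\perp)$ with $(e_f)_*(x)=f_*(x)\wedge f_*(1)^\perp$ and $(e_f)^*(v)=f^*(v)$ satisfies $i_f\circ e_f=f$ and is zero-epi. (iii) The morphism $m_f\colon{\downarrow}(f^*(1)^\perp)\to{\downarrow}(f_*(1)^\perp)$ with $(m_f)_*(x)=f_*(x)\wedge f_*(1)^\perp$ and $(m_f)^*(v)=f^*(v)\wedge f^*(1)^\perp$ satisfies $m_f\circ(i_{f^\dagger})^\dagger=e_f$ (so $f=i_f\circ m_f\circ(i_{f^\dagger})^\dagger$), and $m_f$ is both zero-epi and zero-mono.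
   Context: An orthomodular lattice is a bounded lattice with orthocomplement $x\mapsto x^\perp$ ($x^{\perp\perp}=x$, order-reversing, $x\wedge x^\perp=0$) with $x\le y\Rightarrow y=x\vee(x^\perp\wedge y)$. $\mathbf{OMLatGal}$: objects orthomodular lattices; morphisms $f\colon X\to Y$ pairs $(f_*,f^*)$ of order-reversing maps $f_*\colon X\to Y$, $f^*\colon Y\to X$ with $x\le f^*(y)\iff y\le f_*(x)$; identity $((-)^\perp,(-)^\perp)$; composition $(g\circ f)_*=g_*\circ(-)^\perp\circ f_*$, $(g\circ f)^*=f^*\circ(-)^\perp\circ g^*$; dagger $(f_*,f^*)^\dagger=(f^*,f_*)$; zero object the one-element lattice. For $a\in X$, ${\downarrow}a=\{u\le a\}$ with orthocomplement $u\mapsto a\wedge u^\perp$. It is a dagger kernel category: the kernel of $g\colon X\to Y$ is $k\colon{\downarrow}k\to X$ with $k=g^*(1)$, $k_*(u)=u^\perp$, $k^*(x)=k\wedge x^\perp$; $\mathrm{coker}(g)=\ker(g^\dagger)^\dagger$. So $i_{f^\dagger}\colon{\downarrow}(f^*(1)^\perp)\to X$. A morphism $g$ is zero-epi if $\mathrm{coker}(g)$ is zero (equivalently $h\circ g=0\Rightarrow h=0$), and zero-mono if $g\circ h=0\Rightarrow h=0$ (equivalently $\ker(g)$ is zero). -}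

module Defs where

open import Level using (0ℓ)
open import Data.Product using (Σ; _×_; _,_; proj₁)
open import Relation.Binary using (Rel; IsEquivalence)
open import Function using (_∘_)

record Ortho : Set₁ where
  infix 4 _≈_ _≤_
  infixr 7 _∧_
  infixr 6 _∨_
  infix 9 _ᗮ
  field
    Carrier : Set
    _≈_ : Rel Carrier 0ℓ
    _≤_ : Rel Carrier 0ℓ
    𝟘 𝟙 : Carrier
    _ᗮ : Carrier → Carrier
    _∧_ _∨_ : Carrier → Carrier → Carrier

record IsOML (O : Ortho) : Set where
  open Ortho O
  field
    ≈-equiv      : IsEquivalence _≈_
    ≤-refl       : ∀ {x} → x ≤ x
    ≤-trans      : ∀ {x y z} → x ≤ y → y ≤ z → x ≤ z
    ≤-antisym    : ∀ {x y} → x ≤ y → y ≤ x → x ≈ y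
    ≤-resp-≈     : ∀ {x x′ y y′} → x ≈ x′ → y ≈ y′ → x ≤ y → x′ ≤ y′
    𝟘-min        : ∀ {x} → 𝟘 ≤ x
    𝟙-max        : ∀ {x} → x ≤ 𝟙
    ∧-lbˡ        : ∀ {x y} → x ∧ y ≤ x
    ∧-lbʳ        : ∀ {x y} → x ∧ y ≤ y
    ∧-glb        : ∀ {x y z} → z ≤ x → z ≤ y → z ≤ x ∧ y
    ∨-ubˡ        : ∀ {x y} → x ≤ x ∨ y
    ∨-ubʳ        : ∀ {x y} → y ≤ x ∨ y
    ∨-lub        : ∀ {x y z} → x ≤ z → y ≤ z → x ∨ y ≤ z
    ᗮ-invol      : ∀ {x} → x ᗮ ᗮ ≈ x
    ᗮ-antitone   : ∀ {x y} → x ≤ y → y ᗮ ≤ x ᗮ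
    ∧-ᗮ          : ∀ {x} → x ∧ x ᗮ ≈ 𝟘
    orthomodular : ∀ {x y} → x ≤ y → y ≈ x ∨ (x ᗮ ∧ y)

record OML : Set₁ where
  field
    ortho : Ortho
    isOML : IsOML ortho
  open Ortho ortho public
  open IsOML isOML public

record RawHom (A B : Ortho) : Set where
  constructor ⟨_,_⟩
  field
    push : Ortho.Carrier A → Ortho.Carrier B
    pull : Ortho.Carrier B → Ortho.Carrier A
open RawHom public

record IsMorphism {A B : Ortho} (f : RawHom A B) : Set where
  module A = Ortho A
  module B = Ortho B
  field
    push-antitone : ∀ {x x′} → x A.≤ x′ → push f x′ B.≤ push f x
    pull-antitone : ∀ {y y′} → y B.≤ y′ → pull f y′ A.≤ pull f y
    galois⇒ : ∀ x y → x A.≤ pull f y → y B.≤ push f x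
    galois⇐ : ∀ x y → y B.≤ push f x → x A.≤ pull f y

_≈ₕ_ : {A B : Ortho} → RawHom A B → RawHom A B → Set
_≈ₕ_ {A} {B} f g =
  (∀ x → Ortho._≈_ B (push f x) (push g x)) × (∀ y → Ortho._≈_ A (pull f y) (pull g y))

infixr 9 _∘ₕ_
_∘ₕ_ : {A B C : Ortho} → RawHom B C → RawHom A B → RawHom A C
_∘ₕ_ {B = B} g f = ⟨ push g ∘ Ortho._ᗮ B ∘ push f , pull f ∘ Ortho._ᗮ B ∘ pull g ⟩

_† : {A B : Ortho} → RawHom A B → RawHom B A
f † = ⟨ pull f , push f ⟩

-- Zero morphism A → 0 → B (computed through the one-element lattice):
-- both components are constantly 1.
zeroₕ : (A B : Ortho) → RawHom A B
zeroₕ A B = ⟨ (λ _ → Ortho.𝟙 B) , (λ _ → Ortho.𝟙 A) ⟩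

ZeroEpi : {A B : Ortho} → RawHom A B → Set₁
ZeroEpi {A} {B} g = (Z : OML) (h : RawHom B (OML.ortho Z)) → IsMorphism h →
  (h ∘ₕ g) ≈ₕ zeroₕ A (OML.ortho Z) → h ≈ₕ zeroₕ B (OML.ortho Z)

ZeroMono : {A B : Ortho} → RawHom A B → Set₁
ZeroMono {A} {B} g = (Z : OML) (h : RawHom (OML.ortho Z) A) → IsMorphism h →
  (g ∘ₕ h) ≈ₕ zeroₕ (OML.ortho Z) B → h ≈ₕ zeroₕ (OML.ortho Z) A

↓ : (X : OML) → OML.Carrier X → Ortho
↓ X a = record
  { Carrier = Σ Carrier (λ u → u ≤ a)
  ; _≈_ = λ u v → proj₁ u ≈ proj₁ v
  ; _≤_ = λ u v → proj₁ u ≤ proj₁ v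
  ; 𝟘 = 𝟘 , 𝟘-min
  ; 𝟙 = a , ≤-refl
  ; _ᗮ = λ u → a ∧ proj₁ u ᗮ , ∧-lbˡ
  ; _∧_ = λ { (u , p) (v , q) → u ∧ v , ≤-trans ∧-lbˡ p }
  ; _∨_ = λ { (u , p) (v , q) → u ∨ v , ∨-lub p q }
  }
  where open OML X

ker : (X : OML) {B : Ortho} (g : RawHom (OML.ortho X) B) →
      RawHom (↓ X (pull g (Ortho.𝟙 B))) (OML.ortho X)
ker X {B} g = ⟨ (λ u → proj₁ u ᗮ) , (λ x → k ∧ x ᗮ , ∧-lbˡ) ⟩
  where
  open OML X
  k = pull g (Ortho.𝟙 B)

coker : (Y : OML) {A : Ortho} (g : RawHom A (OML.ortho Y)) →
        RawHom (OML.ortho Y) (↓ Y (push g (Ortho.𝟙 A)))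
coker Y g = ker Y (g †) †

image : (Y : OML) {A : Ortho} (g : RawHom A (OML.ortho Y)) →
        RawHom (↓ Y (OML._ᗮ Y (push g (Ortho.𝟙 A)))) (OML.ortho Y)
image Y g = ker Y (coker Y g)

module _ (X Y : OML) (f : RawHom (OML.ortho X) (OML.ortho Y)) where
  private
    module X = OML X
    module Y = OML Y
    a = push f X.𝟙 Y.ᗮ
    b = pull f Y.𝟙 X.ᗮ

  eₕ : RawHom X.ortho (↓ Y a)
  eₕ = ⟨ (λ x → push f x Y.∧ a , Y.∧-lbʳ) , (λ v → pull f (proj₁ v)) ⟩

  mₕ : RawHom (↓ X b) (↓ Y a)
  mₕ = ⟨ (λ x → push f (proj₁ x) Y.∧ a , Y.∧-lbʳ)
       , (λ v → pull f (proj₁ v) X.∧ b , X.∧-lbʳ) ⟩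

module Submission where

-- Write p = f_*(1), q = f^*(1), a = pᗮ and b = qᗮ.  Everything rests on
-- three observations.
--  * Order theory of one orthomodular lattice (module OMLFacts): de Morgan
--    bounds, "c ≤ d and cᗮ ≤ d force d = 1", and the orthomodular
--    reconstruction (qᗮ ∧ (t ∧ qᗮ)ᗮ)ᗮ = t for q ≤ t.
--  * The Galois connection (module Galois): p lies below every f_*(x), so
--    f^* cannot distinguish y from anything with the same join with p;
--    in particular f^*(a ∧ (a ∧ yᗮ)ᗮ) = f^*(y).
--  * Duality: the dagger preserves morphisms and swaps f_* with f^*,
--    zero-epis with zero-monos, and m_{f†} is literally (m_f)†.
-- e_f and m_f are (co)restrictions of f to down-sets, hence morphisms;
-- a morphism h out of ↓c is zero as soon as every relative complement
-- c ∧ h^*(z)ᗮ is orthogonal to c, which gives both zero-epi statements; zero-mono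
-- of m_f is zero-epi of m_{f†}.

open import Level using (0ℓ)
open import Defs
open import Data.Product using (_×_; _,_; proj₁; proj₂)
open import Relation.Binary using (IsEquivalence; Poset)

module OMLFacts (L : OML) where
  open OML L
  private module Eq = IsEquivalence ≈-equiv

  poset : Poset 0ℓ 0ℓ 0ℓ
  poset = record
    { isPartialOrder = record
      { isPreorder = record
        { isEquivalence = ≈-equiv
        ; reflexive = λ e → ≤-resp-≈ Eq.refl e ≤-refl
        ; trans = ≤-trans }
      ; antisym = ≤-antisym } }

  open Poset poset public using (reflexive)
  open import Relation.Binary.Reasoning.PartialOrder poset public

  ≈⇒≥ : ∀ {x y} → x ≈ y → y ≤ x
  ≈⇒≥ e = reflexive (Eq.sym e)

  ᗮ-swapʳ : ∀ {x y} → x ≤ y ᗮ → y ≤ x ᗮ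
  ᗮ-swapʳ h = ≤-trans (≈⇒≥ ᗮ-invol) (ᗮ-antitone h)

  ᗮ-swapˡ : ∀ {x y} → x ᗮ ≤ y → y ᗮ ≤ x
  ᗮ-swapˡ h = ≤-trans (ᗮ-antitone h) (reflexive ᗮ-invol)

  ᗮ-cong : ∀ {x y} → x ≈ y → x ᗮ ≈ y ᗮ
  ᗮ-cong e = ≤-antisym (ᗮ-antitone (≈⇒≥ e)) (ᗮ-antitone (reflexive e))

  ∧-comm : ∀ {x y} → x ∧ y ≈ y ∧ x
  ∧-comm = ≤-antisym (∧-glb ∧-lbʳ ∧-lbˡ) (∧-glb ∧-lbʳ ∧-lbˡ)

  ∧-monoˡ : ∀ {x x′ y} → x ≤ x′ → x ∧ y ≤ x′ ∧ y
  ∧-monoˡ h = ∧-glb (≤-trans ∧-lbˡ h) ∧-lbʳ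

  ∧-monoʳ : ∀ {x y y′} → y ≤ y′ → x ∧ y ≤ x ∧ y′
  ∧-monoʳ h = ∧-glb ∧-lbˡ (≤-trans ∧-lbʳ h)

  ∧-congˡ : ∀ {x y y′} → y ≈ y′ → x ∧ y ≈ x ∧ y′
  ∧-congˡ e = ≤-antisym (∧-monoʳ (reflexive e)) (∧-monoʳ (≈⇒≥ e))

  ∧-congʳ : ∀ {x x′ y} → x ≈ x′ → x ∧ y ≈ x′ ∧ y
  ∧-congʳ e = ≤-antisym (∧-monoˡ (reflexive e)) (∧-monoˡ (≈⇒≥ e))

  ∨-monoʳ : ∀ {x y y′} → y ≤ y′ → x ∨ y ≤ x ∨ y′
  ∨-monoʳ h = ∨-lub ∨-ubˡ (≤-trans h ∨-ubʳ)

  ∨≤ᗮ∧ᗮ : ∀ {x y} → x ∨ y ≤ (x ᗮ ∧ y ᗮ) ᗮ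
  ∨≤ᗮ∧ᗮ = ∨-lub (ᗮ-swapʳ ∧-lbˡ) (ᗮ-swapʳ ∧-lbʳ)

  ᗮ∧ᗮ≤∨ : ∀ {x y} → (x ᗮ ∧ y ᗮ) ᗮ ≤ x ∨ y
  ᗮ∧ᗮ≤∨ = ᗮ-swapˡ (∧-glb (ᗮ-antitone ∨-ubˡ) (ᗮ-antitone ∨-ubʳ))

  below-𝟘 : ∀ {w c} → w ≤ c → w ≤ c ᗮ → w ≤ 𝟘
  below-𝟘 h h′ = ≤-trans (∧-glb h h′) (reflexive ∧-ᗮ)

  top-cover : ∀ {c d} → c ≤ d → c ᗮ ≤ d → 𝟙 ≤ d
  top-cover h h′ = ≤-trans (ᗮ-swapʳ 𝟘-min)
    (ᗮ-swapˡ (below-𝟘 (ᗮ-swapˡ h′) (ᗮ-antitone h)))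

  complement-fill : ∀ {u c} → u ≤ c → c ∧ u ᗮ ≤ c ᗮ → c ≤ u
  complement-fill {u} {c} u≤c h = begin
    c                ≈⟨ orthomodular u≤c ⟩
    u ∨ (u ᗮ ∧ c)    ≤⟨ ∨-lub ≤-refl (≤-trans (reflexive ∧-comm) c∧uᗮ≤u) ⟩
    u                ∎
    where
    c∧uᗮ≤u : c ∧ u ᗮ ≤ u
    c∧uᗮ≤u = ≤-trans (below-𝟘 ∧-lbˡ h) 𝟘-min

  -- Orthomodularity again: for q ≤ t, t is recovered from its part t ∧ qᗮ
  -- by taking the relative complement in ↓qᗮ and complementing.
  recover : ∀ {q t} → q ≤ t → (q ᗮ ∧ (t ∧ q ᗮ) ᗮ) ᗮ ≈ t
  recover {q} {t} q≤t = ≤-antisym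
    (ᗮ-swapˡ (∧-glb (ᗮ-antitone q≤t) (ᗮ-antitone ∧-lbˡ)))
    (begin
      t                  ≈⟨ orthomodular q≤t ⟩
      q ∨ (q ᗮ ∧ t)      ≤⟨ ∨-lub (ᗮ-swapʳ ∧-lbˡ) (ᗮ-swapʳ r≤[qᗮ∧t]ᗮ) ⟩
      r ᗮ                ∎)
    where
    r = q ᗮ ∧ (t ∧ q ᗮ) ᗮ
    r≤[qᗮ∧t]ᗮ : r ≤ (q ᗮ ∧ t) ᗮ
    r≤[qᗮ∧t]ᗮ = ≤-trans ∧-lbʳ (ᗮ-antitone (reflexive ∧-comm))

module _ {X Y : OML} where
  private
    module X = IsEquivalence (OML.≈-equiv X)
    module Y = IsEquivalence (OML.≈-equiv Y)

  ≈ₕ-sym : {f g : RawHom (OML.ortho X) (OML.ortho Y)} → f ≈ₕ g → g ≈ₕ f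
  ≈ₕ-sym (f≈g₁ , f≈g₂) = (λ x → Y.sym (f≈g₁ x)) , (λ y → X.sym (f≈g₂ y))

  ≈ₕ-trans : {f g h : RawHom (OML.ortho X) (OML.ortho Y)} → f ≈ₕ g → g ≈ₕ h → f ≈ₕ h
  ≈ₕ-trans (f≈g₁ , f≈g₂) (g≈h₁ , g≈h₂) =
    (λ x → Y.trans (f≈g₁ x) (g≈h₁ x)) , (λ y → X.trans (f≈g₂ y) (g≈h₂ y))

ker-∘-congʳ : (Y : OML) {A B : Ortho} (g : RawHom (OML.ortho Y) B)
  {h h′ : RawHom A (↓ Y (pull g (Ortho.𝟙 B)))} →
  h ≈ₕ h′ → (ker Y g ∘ₕ h) ≈ₕ (ker Y g ∘ₕ h′)
ker-∘-congʳ Y g (h≈h′₁ , h≈h′₂) =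
  (λ x → ᗮ-cong (∧-congˡ (ᗮ-cong (h≈h′₁ x)))) , (λ y → h≈h′₂ _)
  where open OMLFacts Y

-- The Galois condition is symmetric, so the dagger of a morphism is one.
†-isMorphism : {A B : Ortho} {f : RawHom A B} → IsMorphism f → IsMorphism (f †)
†-isMorphism fm = record
  { push-antitone = pull-antitone
  ; pull-antitone = push-antitone
  ; galois⇒ = λ x y → galois⇐ y x
  ; galois⇐ = λ x y → galois⇒ y x }
  where open IsMorphism fm

-- Since (g ∘ h)† = h† ∘ g† and 0† = 0 hold on the nose, the dagger turns
-- zero-epis into zero-monos.
zeroEpi†⇒zeroMono : {A B : Ortho} (g : RawHom A B) → ZeroEpi (g †) → ZeroMono g
zeroEpi†⇒zeroMono {A} g g†-epi Z h hm (gh≈0₁ , gh≈0₂) = proj₂ h†≈0 , proj₁ h†≈0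
  where
  h†≈0 : (h †) ≈ₕ zeroₕ A (OML.ortho Z)
  h†≈0 = g†-epi Z (h †) (†-isMorphism hm) (gh≈0₂ , gh≈0₁)

-- Corestriction of g : A → Y to the down-set ↓c: push forward, then meet
-- with c.  The map e_f is the corestriction of f to ↓(f_*(1)ᗮ).
corestrict : (Y : OML) {A : Ortho} → RawHom A (OML.ortho Y) → (c : OML.Carrier Y) →
  RawHom A (↓ Y c)
corestrict Y g c = ⟨ (λ x → push g x ∧ c , ∧-lbʳ) , (λ v → pull g (proj₁ v)) ⟩
  where open OML Y

corestrict-isMorphism : (Y : OML) {A : Ortho} {g : RawHom A (OML.ortho Y)}
  (c : OML.Carrier Y) → IsMorphism g → IsMorphism (corestrict Y g c)
corestrict-isMorphism Y c gm = record
  { push-antitone = λ x≤x′ → ∧-monoˡ (push-antitone x≤x′)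
  ; pull-antitone = pull-antitone
  ; galois⇒ = λ x v x≤g^*v → ∧-glb (galois⇒ x (proj₁ v) x≤g^*v) (proj₂ v)
  ; galois⇐ = λ x v v≤g_*x∧c → galois⇐ x (proj₁ v) (≤-trans v≤g_*x∧c ∧-lbˡ) }
  where
  open OML Y
  open OMLFacts Y
  open IsMorphism gm

-- Restriction of g : X → B to the down-set ↓c, dual to corestriction.
-- The map m_f is the corestriction of the restriction of f.
restrict : (X : OML) {B : Ortho} → RawHom (OML.ortho X) B → (c : OML.Carrier X) →
  RawHom (↓ X c) B
restrict X g c = corestrict X (g †) c †

restrict-isMorphism : (X : OML) {B : Ortho} {g : RawHom (OML.ortho X) B}
  (c : OML.Carrier X) → IsMorphism g → IsMorphism (restrict X g c)
restrict-isMorphism X c gm = †-isMorphism (corestrict-isMorphism X c (†-isMorphism gm))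

-- A morphism h out of ↓c is zero as soon as each h^*(z) has its relative
-- complement c ∧ h^*(z)ᗮ orthogonal to c: then h^*(z) = c is the top of ↓c,
-- and by the Galois condition h_* is constantly 1.
zero-criterion : (Y : OML) (c : OML.Carrier Y) (Z : OML)
  (h : RawHom (↓ Y c) (OML.ortho Z)) → IsMorphism h →
  (∀ z → OML._≤_ Y (OML._∧_ Y c (OML._ᗮ Y (proj₁ (pull h z)))) (OML._ᗮ Y c)) →
  h ≈ₕ zeroₕ (↓ Y c) (OML.ortho Z)
zero-criterion Y c Z h hm H =
  (λ v → Z.≤-antisym Z.𝟙-max (galois⇒ v Z.𝟙 (≤-trans (proj₂ v) (c≤pull Z.𝟙))))
  , (λ z → ≤-antisym (proj₂ (pull h z)) (c≤pull z))
  where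
  open OML Y
  open OMLFacts Y
  open IsMorphism hm
  module Z = OML Z
  c≤pull : ∀ z → c ≤ proj₁ (pull h z)
  c≤pull z = complement-fill (proj₂ (pull h z)) (H z)

module Galois (X Y : OML) (f : RawHom (OML.ortho X) (OML.ortho Y)) (fm : IsMorphism f) where
  open OML Y
  open OMLFacts Y
  open IsMorphism fm
  private module X = OML X

  p : Carrier
  p = push f X.𝟙

  p≤push : ∀ x → p ≤ push f x
  p≤push x = push-antitone X.𝟙-max

  pull-antitone-mod-p : ∀ {y y′} → y′ ≤ p ∨ y → pull f y X.≤ pull f y′
  pull-antitone-mod-p {y} y′≤p∨y =
    galois⇐ _ _ (≤-trans y′≤p∨y (∨-lub (p≤push _) (galois⇒ _ y X.≤-refl)))

  -- Replacing y by the relative complement in ↓pᗮ of its part pᗮ ∧ yᗮ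
  -- does not change f^*(y), because both have the same join with p.
  pull-relative : ∀ y → pull f (p ᗮ ∧ (p ᗮ ∧ y ᗮ) ᗮ) X.≈ pull f y
  pull-relative y = X.≤-antisym (pull-antitone-mod-p y≤p∨s) (pull-antitone-mod-p s≤p∨y)
    where
    s = p ᗮ ∧ (p ᗮ ∧ y ᗮ) ᗮ
    s≤p∨y : s ≤ p ∨ y
    s≤p∨y = ≤-trans ∧-lbʳ ᗮ∧ᗮ≤∨
    y≤p∨s : y ≤ p ∨ s
    y≤p∨s = begin
      y                      ≤⟨ ∨-ubʳ ⟩
      p ∨ y                  ≈⟨ orthomodular ∨-ubˡ ⟩
      p ∨ (p ᗮ ∧ (p ∨ y))    ≤⟨ ∨-monoʳ (∧-monoʳ ∨≤ᗮ∧ᗮ) ⟩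
      p ∨ s                  ∎

  pull-top⇒orthogonal : ∀ {w} → X.𝟙 X.≤ pull f w → w ≤ p ᗮ ᗮ
  pull-top⇒orthogonal {w} 1≤f^*w = ≤-trans (galois⇒ X.𝟙 w 1≤f^*w) (≈⇒≥ ᗮ-invol)

module Factorisation (X Y : OML) (f : RawHom (OML.ortho X) (OML.ortho Y)) (fm : IsMorphism f) where
  private
    module X = OML X
    module Y = OML Y
    module FX = OMLFacts X
    module FY = OMLFacts Y
    module Gf = Galois X Y f fm
    module Gf† = Galois Y X (f †) (†-isMorphism fm)

  a : Y.Carrier
  a = push f X.𝟙 Y.ᗮ

  b : X.Carrier
  b = pull f Y.𝟙 X.ᗮ

  coimage : RawHom X.ortho (↓ X b)
  coimage = image X (f †) †

  image-push : ∀ v → push (image Y f) v Y.≈ proj₁ v Y.ᗮ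
  image-push v = IsEquivalence.refl Y.≈-equiv

  image-pull : ∀ y → proj₁ (pull (image Y f) y) Y.≈ y Y.ᗮ Y.∧ a
  image-pull y = FY.∧-comm

  e-isMorphism : IsMorphism (eₕ X Y f)
  e-isMorphism = corestrict-isMorphism Y a fm

  m-isMorphism : IsMorphism (mₕ X Y f)
  m-isMorphism = corestrict-isMorphism Y a (restrict-isMorphism X b fm)

  -- Both components are the "relative complement" reconstructions: in Y
  -- by orthomodularity (p ≤ f_*(x)), in X through the Galois connection.
  image∘e≈f : (image Y f ∘ₕ eₕ X Y f) ≈ₕ f
  image∘e≈f = (λ x → FY.recover (Gf.p≤push x)) , Gf.pull-relative

  -- The same two facts, with the roles of f and f† exchanged.
  m∘coimage≈e : (mₕ X Y f ∘ₕ coimage) ≈ₕ eₕ X Y f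
  m∘coimage≈e =
    (λ x → FY.∧-congʳ (Gf†.pull-relative x)) , (λ v → FX.recover (Gf†.p≤push _))

  f-factorises : f ≈ₕ (image Y f ∘ₕ (mₕ X Y f ∘ₕ coimage))
  f-factorises =
    ≈ₕ-sym {X = X} {Y = Y} (≈ₕ-trans {X = X} {Y = Y} image∘m∘coimage≈image∘e image∘e≈f)
    where
    image∘m∘coimage≈image∘e : (image Y f ∘ₕ (mₕ X Y f ∘ₕ coimage)) ≈ₕ (image Y f ∘ₕ eₕ X Y f)
    image∘m∘coimage≈image∘e =
      ker-∘-congʳ Y (coker Y f) {h = mₕ X Y f ∘ₕ coimage} {h′ = eₕ X Y f} m∘coimage≈e

  -- h ∘ e_f = 0 says f^*(a ∧ h^*(z)ᗮ) = 1 for every z.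
  e-zeroEpi : ZeroEpi (eₕ X Y f)
  e-zeroEpi Z h hm (_ , he≈0) =
    zero-criterion Y a Z h hm (λ z → Gf.pull-top⇒orthogonal (FX.≈⇒≥ (he≈0 z)))

  -- h ∘ m_f = 0 says f^*(a ∧ h^*(z)ᗮ) lies above b = qᗮ; it also lies
  -- above q = f^*(1), so it is 1.
  m-zeroEpi : ZeroEpi (mₕ X Y f)
  m-zeroEpi Z h hm (_ , hm≈0) = zero-criterion Y a Z h hm λ z →
    Gf.pull-top⇒orthogonal (FX.top-cover (Gf†.p≤push _) (X.≤-trans (FX.≈⇒≥ (hm≈0 z)) X.∧-lbˡ))

lemma3p7 : (X Y : OML) (f : RawHom (OML.ortho X) (OML.ortho Y)) → IsMorphism f →
    ((∀ v → OML._≈_ Y (push (image Y f) v) (OML._ᗮ Y (proj₁ v)))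
    × (∀ y → OML._≈_ Y (proj₁ (pull (image Y f) y))
    (OML._∧_ Y (OML._ᗮ Y y) (OML._ᗮ Y (push f (OML.𝟙 X))))))
    × (IsMorphism (eₕ X Y f) × ((image Y f ∘ₕ eₕ X Y f) ≈ₕ f) × ZeroEpi (eₕ X Y f))
    × (IsMorphism (mₕ X Y f)
    × ((mₕ X Y f ∘ₕ (image X (f †) †)) ≈ₕ eₕ X Y f)
    × (f ≈ₕ (image Y f ∘ₕ (mₕ X Y f ∘ₕ (image X (f †) †))))
    × ZeroEpi (mₕ X Y f) × ZeroMono (mₕ X Y f))
lemma3p7 X Y f fm =
  (image-push , image-pull)
  , (e-isMorphism , image∘e≈f , e-zeroEpi)
  , (m-isMorphism , m∘coimage≈e , f-factorises , m-zeroEpi , m-zeroMono)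
  where
  open Factorisation X Y f fm
  -- m_{f†} is (m_f)† on the nose, so zero-epi of m_{f†} is zero-mono of m_f.
  m-zeroMono : ZeroMono (mₕ X Y f)
  m-zeroMono = zeroEpi†⇒zeroMono (mₕ X Y f)
    (Factorisation.m-zeroEpi Y X (f †) (†-isMorphism fm))
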